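{- For every $l \geq 2$ and $t\geq 1$, $\mathit{fw}(\mathit{up}(l, t))=2t-1$.
   Context: A sequence $s$ contains a sequence $u$ if some subsequence of $s$ can be changed into $u$ by a one-to-one renaming of its letters. An $(r,s)$-formation is a concatenation of $s$ permutations of the same set of $r$ distinct letters. The formation width $\mathit{fw}(u)$ is the minimum $s$ such that there exists $r$ for which every $(r,s)$-formation contains $u$. $\mathit{up}(l,t)$ is the sequence $1\,2\ldots l$ repeated $t$ times (e.g. $\mathit{up}(3,3)=123123123$). -}

module Defs where

open import Data.Nat using (ℕ; suc; _<_)
open import Data.List using (List; map; concat; replicate; length; upTo)
open import Data.List.Membership.Propositional using (_∈_)
open import Data.List.Relation.Unary.All using (All)
open import Data.List.Relation.Unary.Unique.Propositional using (Unique)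
open import Data.List.Relation.Binary.Sublist.Propositional using (_⊆_)
open import Data.List.Relation.Binary.Permutation.Propositional using (_↭_)
open import Data.Product using (Σ; _×_; ∃; ∃-syntax)
open import Relation.Binary.PropositionalEquality using (_≡_)
open import Relation.Nullary using (¬_)

Seq : Set
Seq = List ℕ

Contains : Seq → Seq → Set
Contains s u =
  ∃[ v ] (v ⊆ s) × (∃[ φ ] ((∀ {x y} → x ∈ v → y ∈ v → φ x ≡ φ y → x ≡ y)
                            × map φ v ≡ u))

IsFormation : ℕ → ℕ → Seq → Set
IsFormation r s f =
  ∃[ L ] (length L ≡ r) × Unique L ×
    (∃[ ps ] (length ps ≡ s) × All (_↭ L) ps × (f ≡ concat ps))

FormationForces : Seq → ℕ → Set
FormationForces u s = ∃[ r ] (∀ f → IsFormation r s f → Contains f u)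

FormationWidth : Seq → ℕ → Set
FormationWidth u s = FormationForces u s × (∀ s′ → s′ < s → ¬ FormationForces u s′)

up : ℕ → ℕ → Seq
up l t = concat (replicate t (map suc (upTo l)))

-- Lower bound: the formation L, reverse L, L, reverse L, … with s blocks avoids
-- up(l,t) when s < 2t − 1. A copy of up(2,t) = (12)^t uses two letters a ≠ b,
-- and the formation restricted to {a,b} is x y y x x y …, which has only s + 1
-- runs of equal letters, while (12)^t has no two equal neighbours and so needs 2t.
--
-- Upper bound: iterating the Erdős–Szekeres theorem over the 2t − 1 permutations
-- of a long enough formation gives l letters, listed increasingly as I, such that
-- each permutation contains I or reverse I as a subsequence. By pigeonhole t of
-- the permutations contain the same one of the two, so the formation contains it
-- repeated t times, a renamed copy of up(l,t).

module Submission where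

open import Defs
open import Data.Nat using (ℕ; zero; suc; _+_; _*_; _∸_; _≤_; _<_; _>_; z≤n; s≤s)
open import Data.Nat.Properties
open import Data.List
  using (List; []; _∷_; _++_; [_]; map; concat; replicate; length; upTo; applyUpTo; reverse; filter)
open import Data.List.Properties
  using (filter-++; filter-all; unfold-reverse; ++-identityʳ; length-++-sucʳ; length-map;
         length-reverse; reverse-involutive; length-upTo; map-upTo; map-cong-local; map-∘;
         map-replicate; concat-map; ∷-injective)
open import Data.List.Membership.Propositional using (_∈_)
open import Data.List.Membership.Propositional.Properties
  using (∈-++⁻; ∈-∃++; ∈-map⁺; ∈-filter⁺; ∈-filter⁻)
open import Data.List.Membership.DecPropositional _≟_ using (_∈?_)
open import Data.List.Relation.Unary.Any using (here; there)
open import Data.List.Relation.Unary.All as All using (All; []; _∷_)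
open import Data.List.Relation.Unary.All.Properties
  using (all-filter) renaming (concat⁺ to All-concat⁺)
open import Data.List.Relation.Unary.AllPairs as AllPairs using (AllPairs; []; _∷_)
import Data.List.Relation.Unary.AllPairs.Properties as AllPairs
open import Data.List.Relation.Unary.Linked as Linked using (Linked; []; [-]; _∷_)
import Data.List.Relation.Unary.Linked.Properties as Linked
open import Data.List.Relation.Unary.Unique.Propositional using (Unique)
import Data.List.Relation.Unary.Unique.Propositional.Properties as Unique
open import Data.List.Relation.Binary.Sublist.Propositional
  using (_⊆_; []; _∷_; _∷ʳ_; minimum; ⊆-refl; ⊆-trans)
open import Data.List.Relation.Binary.Sublist.Propositional.Properties
  using (++⁺; ++⁺ˡ; filter-⊆; filter⁺; reverse⁺; map⁺; Any-resp-⊆; All-resp-⊆; ∷ˡ⁻)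
open import Data.List.Relation.Binary.Permutation.Propositional using (_↭_; ↭-refl; ↭-sym; ↭⇒↭ₛ)
open import Data.List.Relation.Binary.Permutation.Propositional.Properties
  using (↭-reverse; ∈-resp-↭; All-resp-↭)
import Data.List.Relation.Binary.Permutation.Setoid.Properties as PermutationSetoid
open import Data.Product using (_×_; _,_; proj₁; proj₂; ∃₂; ∃-syntax)
open import Data.Sum as Sum using (_⊎_; inj₁; inj₂)
open import Data.Empty using (⊥-elim)
open import Data.Bool using (true; false)
open import Function using (_∘_; flip)
open import Relation.Nullary using (¬_; yes; no; does; contradiction)
open import Relation.Unary using (Decidable)
open import Relation.Unary.Properties using (∁?)
open import Relation.Binary.PropositionalEquality
  using (_≡_; _≢_; refl; sym; trans; cong; cong₂; subst; subst₂; setoid; module ≡-Reasoning)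

open PermutationSetoid (setoid ℕ) using (Unique-resp-↭)

private
  variable
    A : Set

alternate : A → A → ℕ → List A
alternate x y zero = []
alternate x y (suc n) = x ∷ alternate y x n

length-alternate : ∀ (x y : A) n → length (alternate x y n) ≡ n
length-alternate x y zero = refl
length-alternate x y (suc n) = cong suc (length-alternate y x n)

All-alternate : ∀ {P : A → Set} {x y} n → P x → P y → All P (alternate x y n)
All-alternate zero px py = []
All-alternate (suc n) px py = px ∷ All-alternate n py px

∈-remove : ∀ {x z : A} ys {zs} → z ∈ ys ++ x ∷ zs → x ≢ z → z ∈ ys ++ zs
∈-remove [] (here refl) x≢z = ⊥-elim (x≢z refl)
∈-remove [] (there z∈zs) _ = z∈zs
∈-remove (y ∷ ys) (here refl) _ = here refl
∈-remove (y ∷ ys) (there z∈) x≢z = there (∈-remove ys z∈ x≢z)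

∈-concat-replicate : ∀ {x : A} n {xs} → x ∈ concat (replicate n xs) → x ∈ xs
∈-concat-replicate (suc n) {xs} x∈ with ∈-++⁻ xs x∈
... | inj₁ x∈xs = x∈xs
... | inj₂ x∈rest = ∈-concat-replicate n x∈rest

map-concat-replicate : ∀ {B : Set} (f : A → B) n xs →
                       map f (concat (replicate n xs)) ≡ concat (replicate n (map f xs))
map-concat-replicate f n xs =
  trans (sym (concat-map (replicate n xs))) (cong concat (map-replicate (map f) n xs))

Unique-length-≤ : ∀ {xs ys : List A} → Unique xs → All (_∈ ys) xs → length xs ≤ length ys
Unique-length-≤ [] [] = z≤n
Unique-length-≤ {xs = x ∷ xs} (x∉xs ∷ uxs) (x∈ys ∷ xs∈ys) with ∈-∃++ x∈ys
... | ys₁ , ys₂ , refl = begin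
  suc (length xs)           ≤⟨ s≤s (Unique-length-≤ uxs (All.zipWith drop (x∉xs , xs∈ys))) ⟩
  suc (length (ys₁ ++ ys₂)) ≡⟨ length-++-sucʳ ys₁ x ys₂ ⟨
  length (ys₁ ++ x ∷ ys₂)   ∎
  where
  open ≤-Reasoning
  drop : ∀ {z} → x ≢ z × z ∈ ys₁ ++ x ∷ ys₂ → z ∈ ys₁ ++ ys₂
  drop (x≢z , z∈) = ∈-remove ys₁ z∈ x≢z

AllPairs-reverse : ∀ {R : A → A → Set} {xs} → AllPairs R xs → AllPairs (flip R) (reverse xs)
AllPairs-reverse {xs = []} [] = []
AllPairs-reverse {xs = x ∷ xs} (Rx ∷ Rxs) rewrite unfold-reverse x xs =
  AllPairs.++⁺ (AllPairs-reverse Rxs) ([] ∷ [])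
    (All.map (_∷ []) (All-resp-↭ (↭-sym (↭-reverse xs)) Rx))

⊆-map-preimage : ∀ {B : Set} (f : A → B) {xs ys} → ys ⊆ map f xs →
                 ∃[ zs ] zs ⊆ xs × map f zs ≡ ys
⊆-map-preimage f {[]} [] = [] , [] , refl
⊆-map-preimage f {x ∷ xs} (.(f x) ∷ʳ σ) with ⊆-map-preimage f σ
... | zs , τ , eq = zs , x ∷ʳ τ , eq
⊆-map-preimage f {x ∷ xs} (refl ∷ σ) with ⊆-map-preimage f σ
... | zs , τ , eq = x ∷ zs , refl ∷ τ , cong (f x ∷_) eq

applyUpTo-⊆ : ∀ (f : ℕ → A) {m n} → m ≤ n → applyUpTo f m ⊆ applyUpTo f n
applyUpTo-⊆ f z≤n = minimum _
applyUpTo-⊆ f (s≤s m≤n) = refl ∷ applyUpTo-⊆ (f ∘ suc) m≤n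

concat-replicate-⊆ : ∀ n {xs ys : List A} → xs ⊆ ys →
                     concat (replicate n xs) ⊆ concat (replicate n ys)
concat-replicate-⊆ zero σ = []
concat-replicate-⊆ (suc n) σ = ++⁺ σ (concat-replicate-⊆ n σ)

module _ {P : A → Set} (P? : Decidable P) where

  filter-reverse : ∀ xs → filter P? (reverse xs) ≡ reverse (filter P? xs)
  filter-reverse [] = refl
  filter-reverse (x ∷ xs) = begin
    filter P? (reverse (x ∷ xs))               ≡⟨ cong (filter P?) (unfold-reverse x xs) ⟩
    filter P? (reverse xs ++ [ x ])            ≡⟨ filter-++ P? (reverse xs) [ x ] ⟩
    filter P? (reverse xs) ++ filter P? [ x ]  ≡⟨ cong (_++ filter P? [ x ]) (filter-reverse xs) ⟩
    reverse (filter P? xs) ++ filter P? [ x ]  ≡⟨ last-step ⟩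
    reverse (filter P? (x ∷ xs))               ∎
    where
    open ≡-Reasoning
    last-step : reverse (filter P? xs) ++ filter P? [ x ] ≡ reverse (filter P? (x ∷ xs))
    last-step with does (P? x)
    ... | true = sym (unfold-reverse x (filter P? xs))
    ... | false = ++-identityʳ _

  filter-concat-alternate : ∀ xs ys n →
    filter P? (concat (alternate xs ys n)) ≡ concat (alternate (filter P? xs) (filter P? ys) n)
  filter-concat-alternate xs ys zero = refl
  filter-concat-alternate xs ys (suc n) =
    trans (filter-++ P? xs _) (cong (filter P? xs ++_) (filter-concat-alternate ys xs n))

  length-filter-∁ : ∀ xs → length (filter P? xs) + length (filter (∁? P?) xs) ≡ length xs
  length-filter-∁ [] = refl
  length-filter-∁ (x ∷ xs) with does (P? x)
  ... | true = cong suc (length-filter-∁ xs)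
  ... | false = trans (+-suc _ _) (cong suc (length-filter-∁ xs))

Contains-⊆ˡ : ∀ {s s′ u} → s ⊆ s′ → Contains s u → Contains s′ u
Contains-⊆ˡ s⊆s′ (v , v⊆s , φ , φ-inj , eq) = v , ⊆-trans v⊆s s⊆s′ , φ , φ-inj , eq

Contains-⊆ʳ : ∀ {s u u′} → u′ ⊆ u → Contains s u → Contains s u′
Contains-⊆ʳ u′⊆u (v , v⊆s , φ , φ-inj , refl) with ⊆-map-preimage φ u′⊆u
... | v′ , v′⊆v , eq = v′ , ⊆-trans v′⊆v v⊆s , φ ,
  (λ x∈ y∈ → φ-inj (Any-resp-⊆ v′⊆v x∈) (Any-resp-⊆ v′⊆v y∈)) , eq

up-⊆ : ∀ {l l′} t → l ≤ l′ → up l t ⊆ up l′ t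
up-⊆ t l≤l′ = concat-replicate-⊆ t (map⁺ suc (applyUpTo-⊆ (λ i → i) l≤l′))

index : List ℕ → ℕ → ℕ
index [] x = 0
index (y ∷ ys) x with x ≟ y
... | yes _ = 0
... | no _ = suc (index ys x)

at : List ℕ → ℕ → ℕ
at [] i = 0
at (y ∷ ys) zero = y
at (y ∷ ys) (suc i) = at ys i

at-index : ∀ {x} ys → x ∈ ys → at ys (index ys x) ≡ x
at-index {x} (y ∷ ys) x∈ with x ≟ y | x∈
... | yes x≡y | _ = sym x≡y
... | no x≢y | here x≡y = ⊥-elim (x≢y x≡y)
... | no _ | there x∈ys = at-index ys x∈ys

index-injective : ∀ ys {x z} → x ∈ ys → z ∈ ys → index ys x ≡ index ys z → x ≡ z
index-injective ys x∈ z∈ eq =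
  trans (sym (at-index ys x∈)) (trans (cong (at ys) eq) (at-index ys z∈))

index-∷ : ∀ {x y} ys → y ≢ x → index (y ∷ ys) x ≡ suc (index ys x)
index-∷ {x} {y} ys y≢x with x ≟ y
... | yes x≡y = ⊥-elim (y≢x (sym x≡y))
... | no _ = refl

map-index : ∀ {ys} → Unique ys → map (index ys) ys ≡ upTo (length ys)
map-index [] = refl
map-index {y ∷ ys} (y∉ys ∷ uys) = cong₂ _∷_ index-head (begin
  map (index (y ∷ ys)) ys    ≡⟨ map-cong-local (All.map (index-∷ ys) y∉ys) ⟩
  map (suc ∘ index ys) ys    ≡⟨ map-∘ ys ⟩
  map suc (map (index ys) ys) ≡⟨ cong (map suc) (map-index uys) ⟩
  map suc (upTo (length ys)) ≡⟨ map-upTo suc (length ys) ⟩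
  applyUpTo suc (length ys)  ∎)
  where
  open ≡-Reasoning
  index-head : index (y ∷ ys) y ≡ 0
  index-head with y ≟ y
  ... | yes _ = refl
  ... | no y≢y = ⊥-elim (y≢y refl)

repeat-contains-up : ∀ t {ys} → Unique ys → Contains (concat (replicate t ys)) (up (length ys) t)
repeat-contains-up t {ys} uys = concat (replicate t ys) , ⊆-refl , suc ∘ index ys , injective , renamed
  where
  open ≡-Reasoning
  injective : ∀ {x z} → x ∈ concat (replicate t ys) → z ∈ concat (replicate t ys) →
              suc (index ys x) ≡ suc (index ys z) → x ≡ z
  injective x∈ z∈ eq =
    index-injective ys (∈-concat-replicate t x∈) (∈-concat-replicate t z∈) (suc-injective eq)
  renamed : map (suc ∘ index ys) (concat (replicate t ys)) ≡ up (length ys) t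
  renamed = begin
    map (suc ∘ index ys) (concat (replicate t ys))
      ≡⟨ map-concat-replicate (suc ∘ index ys) t ys ⟩
    concat (replicate t (map (suc ∘ index ys) ys))
      ≡⟨ cong (concat ∘ replicate t) (map-∘ ys) ⟩
    concat (replicate t (map suc (map (index ys) ys)))
      ≡⟨ cong (λ w → concat (replicate t (map suc w))) (map-index uys) ⟩
    up (length ys) t
      ∎

-- Runs of equal letters

-- runsFrom c w counts the maximal blocks of equal letters of w, except a first
-- block that continues the letter c.
runsFrom : ℕ → List ℕ → ℕ
runsFrom c [] = 0
runsFrom c (x ∷ w) with x ≟ c
... | yes _ = runsFrom x w
... | no _ = suc (runsFrom x w)

runs : List ℕ → ℕ
runs [] = 0
runs (x ∷ w) = suc (runsFrom x w)

runsFrom-∷-≡ : ∀ x w → runsFrom x (x ∷ w) ≡ runsFrom x w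
runsFrom-∷-≡ x w with x ≟ x
... | yes _ = refl
... | no x≢x = ⊥-elim (x≢x refl)

runsFrom-∷-≢ : ∀ {c x} w → c ≢ x → runsFrom c (x ∷ w) ≡ suc (runsFrom x w)
runsFrom-∷-≢ {c} {x} w c≢x with x ≟ c
... | yes x≡c = ⊥-elim (c≢x (sym x≡c))
... | no _ = refl

runsFrom-∷-≤ : ∀ c x w → runsFrom c (x ∷ w) ≤ suc (runsFrom x w)
runsFrom-∷-≤ c x w with x ≟ c
... | yes _ = n≤1+n _
... | no _ = ≤-refl

runsFrom-∷-≥ : ∀ c x w → runsFrom x w ≤ runsFrom c (x ∷ w)
runsFrom-∷-≥ c x w with x ≟ c
... | yes _ = ≤-refl
... | no _ = n≤1+n _

runs-≤ : ∀ c w → runs w ≤ suc (runsFrom c w)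
runs-≤ c [] = z≤n
runs-≤ c (x ∷ w) = s≤s (runsFrom-∷-≥ c x w)

length-≤-runsFrom : ∀ {c u w} → Linked _≢_ (c ∷ u) → u ⊆ w → length u ≤ runsFrom c w
length-≤-runsFrom _ [] = z≤n
length-≤-runsFrom {u = []} _ (_ ∷ʳ _) = z≤n
length-≤-runsFrom {c} {z ∷ u} {x ∷ w} (c≢z ∷ linked) (.x ∷ʳ σ) with z ≟ x
... | yes refl rewrite runsFrom-∷-≢ w c≢z = s≤s (length-≤-runsFrom linked (∷ˡ⁻ σ))
... | no z≢x = ≤-trans (length-≤-runsFrom ((z≢x ∘ sym) ∷ linked) σ) (runsFrom-∷-≥ c x w)
length-≤-runsFrom {c} {z ∷ u} {.z ∷ w} (c≢z ∷ linked) (refl ∷ σ)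
  rewrite runsFrom-∷-≢ w c≢z = s≤s (length-≤-runsFrom linked σ)

length-≤-runs : ∀ {u w} → Linked _≢_ u → u ⊆ w → length u ≤ runs w
length-≤-runs {[]} _ _ = z≤n
length-≤-runs {z ∷ u} {x ∷ w} linked (.x ∷ʳ σ) = ≤-trans (length-≤-runs linked σ) (runs-≤ x w)
length-≤-runs {z ∷ u} linked (refl ∷ σ) = s≤s (length-≤-runsFrom linked σ)

-- Lower bound

zigzag : List ℕ → ℕ → List ℕ
zigzag L s = concat (alternate L (reverse L) s)

zigzag-isFormation : ∀ r s → IsFormation r s (zigzag (upTo r) s)
zigzag-isFormation r s =
  upTo r , length-upTo r , Unique.upTo⁺ r , alternate (upTo r) (reverse (upTo r)) s ,
  length-alternate _ _ s , All-alternate s ↭-refl (↭-reverse (upTo r)) , refl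

zigzag-letters : ∀ L s → All (_∈ L) (zigzag L s)
zigzag-letters L s =
  All-concat⁺ (All-alternate s (All.tabulate (λ x∈ → x∈))
                               (All.tabulate (∈-resp-↭ (↭-reverse L))))

filter-zigzag : ∀ {P : ℕ → Set} (P? : Decidable P) L s →
                filter P? (zigzag L s) ≡ zigzag (filter P? L) s
filter-zigzag P? L s = trans (filter-concat-alternate P? L (reverse L) s)
  (cong (λ B → concat (alternate (filter P? L) B s)) (filter-reverse P? L))

runsFrom-zigzag-pair : ∀ x y s → runsFrom x (zigzag (x ∷ y ∷ []) s) ≤ s
runsFrom-zigzag-pair x y zero = z≤n
runsFrom-zigzag-pair x y (suc s) = begin
  runsFrom x (x ∷ y ∷ zigzag (y ∷ x ∷ []) s) ≡⟨ runsFrom-∷-≡ x _ ⟩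
  runsFrom x (y ∷ zigzag (y ∷ x ∷ []) s)     ≤⟨ runsFrom-∷-≤ x y _ ⟩
  suc (runsFrom y (zigzag (y ∷ x ∷ []) s))   ≤⟨ s≤s (runsFrom-zigzag-pair y x s) ⟩
  suc s                                      ∎
  where open ≤-Reasoning

runs-zigzag-pair : ∀ x y s → runs (zigzag (x ∷ y ∷ []) s) ≤ suc s
runs-zigzag-pair x y s = ≤-trans (runs-≤ x _) (s≤s (runsFrom-zigzag-pair x y s))

filter-pair : ∀ {L a b} → Unique L → a ∈ L → b ∈ L → a ≢ b →
              ∃₂ λ x y → filter (_∈? a ∷ b ∷ []) L ≡ x ∷ y ∷ []
filter-pair {L} {a} {b} uL a∈L b∈L a≢b = pair (≤-antisym at-most-two at-least-two)
  where
  P? = _∈? a ∷ b ∷ []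
  at-most-two : length (filter P? L) ≤ 2
  at-most-two =
    Unique-length-≤ (Unique.filter⁺ P? uL) (All.tabulate (proj₂ ∘ ∈-filter⁻ P? {xs = L}))
  at-least-two : 2 ≤ length (filter P? L)
  at-least-two = Unique-length-≤ ((a≢b ∷ []) ∷ [] ∷ [])
    (∈-filter⁺ P? a∈L (here refl) ∷ ∈-filter⁺ P? b∈L (there (here refl)) ∷ [])
  pair : ∀ {xs : List ℕ} → length xs ≡ 2 → ∃₂ λ x y → xs ≡ x ∷ y ∷ []
  pair {x ∷ y ∷ []} _ = x , y , refl

zigzag-sublist-length : ∀ {L a b v} s → Unique L → a ∈ L → b ∈ L → a ≢ b →
  v ⊆ zigzag L s → All (_∈ a ∷ b ∷ []) v → Linked _≢_ v → length v ≤ suc s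
zigzag-sublist-length {L} {a} {b} {v} s uL a∈L b∈L a≢b v⊆ v∈ab linked
  with filter-pair uL a∈L b∈L a≢b
... | x , y , filter≡xy = ≤-trans (length-≤-runs linked v⊆xy) (runs-zigzag-pair x y s)
  where
  P? = _∈? a ∷ b ∷ []
  v⊆xy : v ⊆ zigzag (x ∷ y ∷ []) s
  v⊆xy = subst₂ _⊆_ (filter-all P? v∈ab)
    (trans (filter-zigzag P? L s) (cong (λ F → zigzag F s) filter≡xy))
    (filter⁺ P? P? (λ { refl p → p }) v⊆)

length-up2 : ∀ t → length (up 2 t) ≡ 2 * t
length-up2 zero = refl
length-up2 (suc t) = trans (cong (2 +_) (length-up2 t)) (sym (*-suc 2 t))

linked-up2 : ∀ t → Linked _≢_ (up 2 t)
linked-up2 zero = []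
linked-up2 (suc zero) = (λ ()) ∷ [-]
linked-up2 (suc (suc t)) = (λ ()) ∷ (λ ()) ∷ linked-up2 (suc t)

zigzag-contains-up2 : ∀ {L s} t → Unique L → Contains (zigzag L s) (up 2 t) → 2 * t ≤ suc s
zigzag-contains-up2 zero _ _ = z≤n
zigzag-contains-up2 (suc t) _ ([] , _ , _ , _ , ())
zigzag-contains-up2 (suc t) _ (_ ∷ [] , _ , _ , _ , ())
zigzag-contains-up2 {L} {s} (suc t) uL (a ∷ b ∷ v₀ , v⊆ , φ , φ-inj , eq) = begin
  2 * suc t              ≡⟨ length-up2 (suc t) ⟨
  length (up 2 (suc t))  ≡⟨ cong length eq ⟨
  length (map φ v)       ≡⟨ length-map φ v ⟩
  length v               ≤⟨ zigzag-sublist-length s uL a∈L b∈L a≢b v⊆ letters linked ⟩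
  suc s                  ∎
  where
  open ≤-Reasoning
  v = a ∷ b ∷ v₀
  φa≡1 : φ a ≡ 1
  φa≡1 = proj₁ (∷-injective eq)
  φb≡2 : φ b ≡ 2
  φb≡2 = proj₁ (∷-injective (proj₂ (∷-injective eq)))
  a≢b : a ≢ b
  a≢b a≡b with trans (sym φa≡1) (trans (cong φ a≡b) φb≡2)
  ... | ()
  in-L : ∀ {x} → x ∈ v → x ∈ L
  in-L x∈v = All.lookup (zigzag-letters L s) (Any-resp-⊆ v⊆ x∈v)
  a∈L = in-L (here refl)
  b∈L = in-L (there (here refl))
  letter : ∀ {x} → x ∈ v → φ x ∈ 1 ∷ 2 ∷ [] → x ∈ a ∷ b ∷ []
  letter x∈v (here φx≡1) = here (φ-inj x∈v (here refl) (trans φx≡1 (sym φa≡1)))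
  letter x∈v (there (here φx≡2)) =
    there (here (φ-inj x∈v (there (here refl)) (trans φx≡2 (sym φb≡2))))
  letters : All (_∈ a ∷ b ∷ []) v
  letters = All.tabulate λ {x} x∈v →
    letter x∈v (∈-concat-replicate (suc t) (subst (φ x ∈_) eq (∈-map⁺ φ x∈v)))
  linked : Linked _≢_ v
  linked = Linked.map (λ φx≢φy → φx≢φy ∘ cong φ)
    (Linked.map⁻ (subst (Linked _≢_) (sym eq) (linked-up2 (suc t))))

¬forces-up : ∀ {l t s} → 2 ≤ l → s < 2 * t ∸ 1 → ¬ FormationForces (up l t) s
¬forces-up {t = zero} _ ()
¬forces-up {t = suc t} {s} 2≤l s<2t∸1 (r , forces) =
  -- 2 * suc t ∸ 1 computes to n where 2 * suc t computes to suc n.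
  1+n≰n (≤-trans (zigzag-contains-up2 (suc t) (Unique.upTo⁺ r) contains) s<2t∸1)
  where
  contains : Contains (zigzag (upTo r) s) (up 2 (suc t))
  contains = Contains-⊆ʳ (up-⊆ (suc t) 2≤l) (forces _ (zigzag-isFormation r s))

-- Upper bound

Increasing Decreasing : List ℕ → Set
Increasing = AllPairs _<_
Decreasing = AllPairs _>_

Increasing⇒Unique : ∀ {xs} → Increasing xs → Unique xs
Increasing⇒Unique = AllPairs.map <⇒≢

m+n≤o+p∧o≤m⇒n≤p : ∀ {m n o p} → o ≤ m → m + n ≤ o + p → n ≤ p
m+n≤o+p∧o≤m⇒n≤p {m} {n} {o} {p} o≤m le = +-cancelˡ-≤ o n p (≤-trans (+-monoˡ-≤ n o≤m) le)

es : ℕ → ℕ → ℕ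
es zero b = 0
es (suc a) zero = 0
es (suc a) (suc b) = suc (es a (suc b) + es (suc a) b)

IncreasingSublist DecreasingSublist : ℕ → List ℕ → Set
IncreasingSublist a q = ∃[ I ] Increasing I × length I ≡ a × I ⊆ q
DecreasingSublist b q = ∃[ D ] Decreasing D × length D ≡ b × D ⊆ q

-- Split the tail at the head x: an increasing sublist above x, or a decreasing
-- one below x, extends by x; es satisfies the recurrence this needs.
erdős-szekeres : ∀ a b {q} → Unique q → es a b ≤ length q →
                 IncreasingSublist a q ⊎ DecreasingSublist b q
erdős-szekeres zero b _ _ = inj₁ ([] , [] , refl , minimum _)
erdős-szekeres (suc a) zero _ _ = inj₂ ([] , [] , refl , minimum _)
erdős-szekeres (suc a) (suc b) {x ∷ q} (x∉q ∷ uq) (s≤s long)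
  with es a (suc b) ≤? length (filter (x <?_) q)
... | yes long-above = Sum.map add-x skip-x
  (erdős-szekeres a (suc b) (Unique.filter⁺ (x <?_) uq) long-above)
  where
  above⊆q = filter-⊆ (x <?_) q
  add-x : IncreasingSublist a (filter (x <?_) q) → IncreasingSublist (suc a) (x ∷ q)
  add-x (I , incI , refl , I⊆) =
    x ∷ I , All-resp-⊆ I⊆ (all-filter (x <?_) q) ∷ incI , refl , refl ∷ ⊆-trans I⊆ above⊆q
  skip-x : DecreasingSublist (suc b) (filter (x <?_) q) → DecreasingSublist (suc b) (x ∷ q)
  skip-x (D , decD , lenD , D⊆) = D , decD , lenD , x ∷ʳ ⊆-trans D⊆ above⊆q
... | no short-above = Sum.map skip-x add-x
  (erdős-szekeres (suc a) b (Unique.filter⁺ (∁? (x <?_)) uq) long-below)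
  where
  below = filter (∁? (x <?_)) q
  below⊆q = filter-⊆ (∁? (x <?_)) q
  long-below : es (suc a) b ≤ length below
  long-below = m+n≤o+p∧o≤m⇒n≤p (<⇒≤ (≰⇒> short-above))
    (≤-trans long (≤-reflexive (sym (length-filter-∁ (x <?_) q))))
  below-x : All (_< x) below
  below-x = All.zipWith (λ (x≮y , x≢y) → ≤∧≢⇒< (≮⇒≥ x≮y) (x≢y ∘ sym))
    (all-filter (∁? (x <?_)) q , All-resp-⊆ below⊆q x∉q)
  skip-x : IncreasingSublist (suc a) below → IncreasingSublist (suc a) (x ∷ q)
  skip-x (I , incI , lenI , I⊆) = I , incI , lenI , x ∷ʳ ⊆-trans I⊆ below⊆q
  add-x : DecreasingSublist b below → DecreasingSublist (suc b) (x ∷ q)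
  add-x (D , decD , refl , D⊆) =
    x ∷ D , All-resp-⊆ D⊆ below-x ∷ decD , refl , refl ∷ ⊆-trans D⊆ below⊆q

_⊆±_ : List ℕ → List ℕ → Set
I ⊆± p = I ⊆ p ⊎ reverse I ⊆ p

⊆±-⊆-trans : ∀ {I p q} → I ⊆± p → p ⊆ q → I ⊆± q
⊆±-⊆-trans I⊆±p p⊆q = Sum.map (λ σ → ⊆-trans σ p⊆q) (λ σ → ⊆-trans σ p⊆q) I⊆±p

⊆-⊆±-trans : ∀ {J I p} → J ⊆ I → I ⊆± p → J ⊆± p
⊆-⊆±-trans J⊆I = Sum.map (⊆-trans J⊆I) (⊆-trans (reverse⁺ J⊆I))

⊆±⇒∈ : ∀ {I p} → I ⊆± p → All (_∈ p) I
⊆±⇒∈ (inj₁ I⊆p) = All.tabulate (Any-resp-⊆ I⊆p)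
⊆±⇒∈ {I} (inj₂ rI⊆p) = All.tabulate (Any-resp-⊆ rI⊆p ∘ ∈-resp-↭ (↭-sym (↭-reverse I)))

monotone-sublist : ∀ l {q} → Unique q → es l l ≤ length q →
                   ∃[ I ] Increasing I × length I ≡ l × I ⊆± q
monotone-sublist l uq long with erdős-szekeres l l uq long
... | inj₁ (I , incI , lenI , I⊆q) = I , incI , lenI , inj₁ I⊆q
... | inj₂ (D , decD , lenD , D⊆q) =
  reverse D , AllPairs-reverse decD , trans (length-reverse D) lenD ,
  inj₂ (subst (_⊆ _) (sym (reverse-involutive D)) D⊆q)

Increasing-⊆ : ∀ {J I} → Increasing J → Increasing I → All (_∈ I) J → J ⊆ I
Increasing-⊆ {[]} _ _ _ = minimum _
Increasing-⊆ {j ∷ J} {x ∷ I} (j<J ∷ incJ) (x<I ∷ incI) (here refl ∷ J∈xI) =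
  refl ∷ Increasing-⊆ incJ incI
           (All.zipWith (λ (y∈ , j<y) → ∈-remove [] y∈ (<⇒≢ j<y)) (J∈xI , j<J))
Increasing-⊆ {j ∷ J} {x ∷ I} incjJ@(j<J ∷ _) (x<I ∷ incI) (there j∈I ∷ J∈xI) =
  x ∷ʳ Increasing-⊆ incjJ incI
         (All.zipWith (λ (y∈ , x<y) → ∈-remove [] y∈ (<⇒≢ x<y)) (there j∈I ∷ J∈xI , x<jJ))
  where
  x<j = All.lookup x<I j∈I
  x<jJ = x<j ∷ All.map (<-trans x<j) j<J

monotone-sublist-of : ∀ l {I p} → Increasing I → es l l ≤ length I → Unique p → All (_∈ p) I →
                      ∃[ J ] Increasing J × length J ≡ l × J ⊆ I × J ⊆± p
monotone-sublist-of l {I} {p} incI long up I∈p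
  with monotone-sublist l (Unique.filter⁺ (_∈? I) up) long′
  where
  long′ : es l l ≤ length (filter (_∈? I) p)
  long′ = ≤-trans long (Unique-length-≤ (Increasing⇒Unique incI)
    (All.tabulate λ x∈I → ∈-filter⁺ (_∈? I) (All.lookup I∈p x∈I) x∈I))
... | J , incJ , lenJ , J⊆±q = J , incJ , lenJ ,
  Increasing-⊆ incJ incI (All.map (proj₂ ∘ ∈-filter⁻ (_∈? I) {xs = p}) (⊆±⇒∈ J⊆±q)) ,
  ⊆±-⊆-trans J⊆±q (filter-⊆ (_∈? I) p)

es-iterate : ℕ → ℕ → ℕ
es-iterate zero l = es l l
es-iterate (suc k) l = es-iterate k (es l l)

common-monotone-sublist : ∀ k l {L} → Unique L → es-iterate k l ≤ length L →
  ∀ {ps} → length ps ≡ k → All (_↭ L) ps →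
  ∃[ I ] Increasing I × length I ≡ l × All (_∈ L) I × All (I ⊆±_) ps
common-monotone-sublist zero l uL long {[]} _ [] with monotone-sublist l uL long
... | I , incI , lenI , I⊆±L = I , incI , lenI , ⊆±⇒∈ I⊆±L , []
common-monotone-sublist (suc k) l uL long {p ∷ ps} lenps (p↭L ∷ ps↭L)
  with common-monotone-sublist k (es l l) uL long (suc-injective lenps) ps↭L
... | I , incI , lenI , I∈L , I⊆±ps
  with monotone-sublist-of l incI (≤-reflexive (sym lenI))
         (Unique-resp-↭ (↭⇒↭ₛ (↭-sym p↭L)) uL) (All.map (∈-resp-↭ (↭-sym p↭L)) I∈L)
... | J , incJ , lenJ , J⊆I , J⊆±p =
  J , incJ , lenJ , All-resp-⊆ J⊆I I∈L , J⊆±p ∷ All.map (⊆-⊆±-trans J⊆I) I⊆±ps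

repeat-⊆-concat : ∀ {X Y : List ℕ} m n {ps} →
  All (λ p → X ⊆ p ⊎ Y ⊆ p) ps → m + n ≤ suc (length ps) →
  concat (replicate m X) ⊆ concat ps ⊎ concat (replicate n Y) ⊆ concat ps
repeat-⊆-concat zero n _ _ = inj₁ (minimum _)
repeat-⊆-concat (suc m) zero _ _ = inj₂ (minimum _)
repeat-⊆-concat (suc m) (suc n) {[]} [] (s≤s m+1+n≤0) =
  contradiction (≤-trans (m≤n+m (suc n) m) m+1+n≤0) λ ()
repeat-⊆-concat (suc m) (suc n) {p ∷ ps} (inj₁ X⊆p ∷ rest) (s≤s le) =
  Sum.map (++⁺ X⊆p) (++⁺ˡ p) (repeat-⊆-concat m (suc n) rest le)
repeat-⊆-concat (suc m) (suc n) {p ∷ ps} (inj₂ Y⊆p ∷ rest) (s≤s le) =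
  Sum.map (++⁺ˡ p) (++⁺ Y⊆p)
    (repeat-⊆-concat (suc m) n rest (subst (_≤ suc (length ps)) (+-suc m n) le))

m+m≤1+[2m∸1] : ∀ m → m + m ≤ suc (2 * m ∸ 1)
m+m≤1+[2m∸1] zero = z≤n
m+m≤1+[2m∸1] (suc m) = ≤-reflexive (cong (λ k → suc (m + suc k)) (sym (+-identityʳ m)))

contains-up : ∀ {W f} t → Unique W → concat (replicate t W) ⊆ f → Contains f (up (length W) t)
contains-up t uW W⊆f = Contains-⊆ˡ W⊆f (repeat-contains-up t uW)

forces-up : ∀ l t → FormationForces (up l t) (2 * t ∸ 1)
forces-up l t = es-iterate (2 * t ∸ 1) l , forces
  where
  forces : ∀ f → IsFormation (es-iterate (2 * t ∸ 1) l) (2 * t ∸ 1) f → Contains f (up l t)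
  forces f (L , lenL , uL , ps , lenps , ps↭L , refl)
    with common-monotone-sublist (2 * t ∸ 1) l uL (≤-reflexive (sym lenL)) lenps ps↭L
  ... | I , incI , refl , _ , I⊆±ps
    with repeat-⊆-concat t t I⊆±ps (subst (λ k → t + t ≤ suc k) (sym lenps) (m+m≤1+[2m∸1] t))
  ... | inj₁ I⊆f = contains-up t (Increasing⇒Unique incI) I⊆f
  ... | inj₂ rI⊆f = subst (λ k → Contains f (up k t)) (length-reverse I)
    (contains-up t (AllPairs.map (λ y<x → <⇒≢ y<x ∘ sym) (AllPairs-reverse incI)) rI⊆f)

theorem2p10 : (l t : ℕ) → 2 ≤ l → 1 ≤ t → FormationWidth (up l t) (2 * t ∸ 1)
theorem2p10 l t 2≤l _ = forces-up l t , λ s s<2t∸1 → ¬forces-up {t = t} 2≤l s<2t∸1
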